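{- Let $\sigma^{:}$ and $\pi^{:}$ be decorated permutations on $[n]$, with Grassmann necklaces $I^{\sigma},I^{\pi}$, Grassmann conecklaces $J^{\sigma},J^{\pi}$, and Grassmann intervals $S^{\sigma}_1,\dots,S^{\sigma}_n$ and $S^{\pi}_1,\dots,S^{\pi}_n$. Then (1) $I^{\sigma}_i\subseteq I^{\pi}_i$ for all $i\in[n]$ if and only if $S^{\sigma}_i\subseteq S^{\pi}_i$ for all $i\in[n]$; and (2) $J^{\sigma}_i\subseteq J^{\pi}_i$ for all $i\in[n]$ if and only if $S^{\sigma}_{\sigma(i)}\subseteq S^{\pi}_{\pi(i)}$ for all $i\in[n]$.
   Context: For $i\in[n]$ the cyclic order $<_i$ is $i<_i i+1<_i\cdots<_i n<_i 1<_i\cdots<_i i-1$. A decorated permutation on $[n]$ is a pair $(\pi,\operatorname{col})$, $\pi$ a permutation of $[n]$, $\operatorname{col}:[n]\to\{0,1,-1\}$ with $\operatorname{col}(i)=0$ iff $\pi(i)\ne i$. Its Grassmann necklace is $I_i=\{j: j<_i\pi^{ -1}(j)\text{ or }\operatorname{col}(j)=-1\}$ and its Grassmann conecklace is $J_i=\pi^{ -1}(I_i)$. For $a,b\in[n]$ the cyclic interval $(a,b]$ is $\{a+1,a+2,\dots,b\}$ (indices mod $n$), with $(a,a]=\emptyset$. The Grassmann interval is $S^{\pi}_i=(\pi^{ -1}(i),i]$, except that $S^{\pi}_i=[n]$ when $\pi(i)=i$ and $\operatorname{col}(i)=-1$. -}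

module Defs where

open import Data.Nat using (ℕ; _+_; _∸_; _≤_; _<_; _≤ᵇ_)
open import Data.Bool using (if_then_else_)
open import Data.Fin using (Fin; toℕ)
open import Data.Fin.Permutation using (Permutation′; _⟨$⟩ʳ_; _⟨$⟩ˡ_)
open import Data.Product using (_×_)
open import Data.Sum using (_⊎_)
open import Data.Unit using (⊤)
open import Relation.Binary.PropositionalEquality using (_≡_; _≢_)
open import Function.Bundles using (_⇔_)

-- [n] is modelled by Fin n (0-based: element k of Fin n is k+1 ∈ [n]);
-- the cyclic structure is identical.

data Col : Set where
  c0 c+1 c-1 : Col

record DecoratedPerm (n : ℕ) : Set where
  field
    perm   : Permutation′ n
    col    : Fin n → Col
    col-ok : ∀ i → (col i ≡ c0) ⇔ (perm ⟨$⟩ʳ i ≢ i)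
open DecoratedPerm public

-- position of j in the cyclic order <_i  (i ↦ 0, i+1 ↦ 1, ..., i-1 ↦ n-1)
rank : ∀ {n} → Fin n → Fin n → ℕ
rank {n} i j =
  if toℕ i ≤ᵇ toℕ j then toℕ j ∸ toℕ i else (n + toℕ j) ∸ toℕ i

_<[_]_ : ∀ {n} → Fin n → Fin n → Fin n → Set
j <[ i ] k = rank i j < rank i k

Subset : ℕ → Set₁
Subset n = Fin n → Set

_⊆_ : ∀ {n} → Subset n → Subset n → Set
A ⊆ B = ∀ j → A j → B j

-- cyclic interval (a,b] = {a+1, ..., b}; (a,a] = ∅
cycInterval : ∀ {n} → Fin n → Fin n → Subset n
cycInterval a b j = (0 < rank a j) × (rank a j ≤ rank a b)

necklace : ∀ {n} → DecoratedPerm n → Fin n → Subset n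
necklace σ i j = (j <[ i ] (perm σ ⟨$⟩ˡ j)) ⊎ (col σ j ≡ c-1)

conecklace : ∀ {n} → DecoratedPerm n → Fin n → Subset n
conecklace σ i k = necklace σ i (perm σ ⟨$⟩ʳ k)

grassInterval : ∀ {n} → DecoratedPerm n → Fin n → Subset n
grassInterval σ i j =
  ((perm σ ⟨$⟩ʳ i ≡ i) × (col σ i ≡ c-1))
  ⊎ (((perm σ ⟨$⟩ʳ i ≢ i) ⊎ (col σ i ≢ c-1)) × cycInterval (perm σ ⟨$⟩ˡ i) i j)

-- Both parts are transpositions of the single fact  j ∈ I_i ⇔ i ∈ S_j.
-- A fixed point j of colour -1 lies in every I_i and has S_j = [n]. Otherwise
-- both sides say that i, j, σ⁻¹(j) are cyclically ordered:  j <_i σ⁻¹(j)  iff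
-- i ∈ (σ⁻¹(j), j].  Since J_i = σ⁻¹(I_i), part (2) is the same transposition
-- with j = σ(k).
module Submission where

open import Defs
open import Data.Nat using (ℕ; _+_; _∸_; _≤_; _<_; _≤ᵇ_; _≤?_)
open import Data.Nat.Properties
open import Data.Bool using (true; false)
open import Data.Unit using (tt)
open import Data.Product using (_×_; _,_)
open import Data.Sum using (inj₁; inj₂)
open import Data.Fin using (Fin; toℕ)
open import Data.Fin.Properties using (toℕ<n) renaming (_≟_ to _≟ᶠ_)
open import Data.Fin.Permutation using (_⟨$⟩ʳ_)
open import Function using (_∘′_)
open import Function.Bundles using (_⇔_; mk⇔; Equivalence)
open import Relation.Nullary using (yes; no; contradiction)
open import Relation.Binary.PropositionalEquality using (_≡_; refl; sym; trans; subst₂)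

m∸o<n∸o⇒m<n : ∀ {m n o} → m ∸ o < n ∸ o → m < n
m∸o<n∸o⇒m<n {o = o} lt = ≰⇒> (λ n≤m → <⇒≱ lt (∸-monoˡ-≤ o n≤m))

m∸o≤n∸o⇒m≤n : ∀ {m n o} → o ≤ m → o ≤ n → m ∸ o ≤ n ∸ o → m ≤ n
m∸o≤n∸o⇒m≤n {o = o} o≤m o≤n le =
  subst₂ _≤_ (m∸n+n≡m o≤m) (m∸n+n≡m o≤n) (+-monoˡ-≤ o le)

0<m∸n⇒n<m : ∀ {m n} → 0 < m ∸ n → n < m
0<m∸n⇒n<m = m∸n≢0⇒n<m ∘′ n>0⇒n≢0

data CyclicallyOrdered (x y z : ℕ) : Set where
  x≤y<z : x ≤ y → y < z → CyclicallyOrdered x y z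
  y<z<x : y < z → z < x → CyclicallyOrdered x y z
  z<x≤y : z < x → x ≤ y → CyclicallyOrdered x y z

module _ {n : ℕ} where

  toℕ≤n+ : (x : Fin n) (m : ℕ) → toℕ x ≤ n + m
  toℕ≤n+ x m = ≤-trans (<⇒≤ (toℕ<n x)) (m≤m+n n m)

  toℕ<n+ : (x : Fin n) (m : ℕ) → toℕ x < n + m
  toℕ<n+ x m = <-≤-trans (toℕ<n x) (m≤m+n n m)

  rank-≤ : (i j : Fin n) → toℕ i ≤ toℕ j → rank i j ≡ toℕ j ∸ toℕ i
  rank-≤ i j i≤j with toℕ i ≤ᵇ toℕ j | ≤⇒≤ᵇ i≤j
  ... | true | _ = refl

  rank-> : (i j : Fin n) → toℕ j < toℕ i → rank i j ≡ n + toℕ j ∸ toℕ i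
  rank-> i j j<i with toℕ i ≤ᵇ toℕ j | ≤ᵇ⇒≤ (toℕ i) (toℕ j)
  ... | false | _    = refl
  ... | true  | i≤j = contradiction (i≤j tt) (<⇒≱ j<i)

  <[]⇒cyclic : (i j a : Fin n) →
    j <[ i ] a → CyclicallyOrdered (toℕ i) (toℕ j) (toℕ a)
  <[]⇒cyclic i j a lt with toℕ i ≤? toℕ j | toℕ i ≤? toℕ a
  ... | yes i≤j | yes i≤a rewrite rank-≤ i j i≤j | rank-≤ i a i≤a =
    x≤y<z i≤j (m∸o<n∸o⇒m<n {o = toℕ i} lt)
  ... | yes i≤j | no i≰a = z<x≤y (≰⇒> i≰a) i≤j
  ... | no i≰j | yes i≤a rewrite rank-> i j (≰⇒> i≰j) | rank-≤ i a i≤a =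
    contradiction lt (<-asym (∸-monoˡ-< (toℕ<n+ a (toℕ j)) i≤a))
  ... | no i≰j | no i≰a rewrite rank-> i j (≰⇒> i≰j) | rank-> i a (≰⇒> i≰a) =
    y<z<x (+-cancelˡ-< n _ _ (m∸o<n∸o⇒m<n {o = toℕ i} lt)) (≰⇒> i≰a)

  cyclic⇒<[] : (i j a : Fin n) →
    CyclicallyOrdered (toℕ i) (toℕ j) (toℕ a) → j <[ i ] a
  cyclic⇒<[] i j a (x≤y<z i≤j j<a)
    rewrite rank-≤ i j i≤j | rank-≤ i a (≤-trans i≤j (<⇒≤ j<a)) =
    ∸-monoˡ-< j<a i≤j
  cyclic⇒<[] i j a (y<z<x j<a a<i)
    rewrite rank-> i j (<-trans j<a a<i) | rank-> i a a<i =
    ∸-monoˡ-< (+-monoʳ-< n j<a) (toℕ≤n+ i (toℕ j))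
  cyclic⇒<[] i j a (z<x≤y a<i i≤j) rewrite rank-≤ i j i≤j | rank-> i a a<i =
    ∸-monoˡ-< (toℕ<n+ j (toℕ a)) i≤j

  cycInterval⇒cyclic : (i j a : Fin n) →
    cycInterval a j i → CyclicallyOrdered (toℕ i) (toℕ j) (toℕ a)
  cycInterval⇒cyclic i j a (pos , le) with toℕ a ≤? toℕ i | toℕ a ≤? toℕ j
  ... | yes a≤i | yes a≤j rewrite rank-≤ a i a≤i | rank-≤ a j a≤j =
    z<x≤y (0<m∸n⇒n<m pos) (m∸o≤n∸o⇒m≤n a≤i a≤j le)
  ... | yes a≤i | no a≰j rewrite rank-≤ a i a≤i = y<z<x (≰⇒> a≰j) (0<m∸n⇒n<m pos)
  ... | no a≰i | yes a≤j rewrite rank-> a i (≰⇒> a≰i) | rank-≤ a j a≤j =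
    contradiction (m∸o≤n∸o⇒m≤n (toℕ≤n+ a (toℕ i)) a≤j le) (<⇒≱ (toℕ<n+ j (toℕ i)))
  ... | no a≰i | no a≰j rewrite rank-> a i (≰⇒> a≰i) | rank-> a j (≰⇒> a≰j) =
    x≤y<z (+-cancelˡ-≤ n _ _ (m∸o≤n∸o⇒m≤n (toℕ≤n+ a (toℕ i)) (toℕ≤n+ a (toℕ j)) le))
          (≰⇒> a≰j)

  cyclic⇒cycInterval : (i j a : Fin n) →
    CyclicallyOrdered (toℕ i) (toℕ j) (toℕ a) → cycInterval a j i
  cyclic⇒cycInterval i j a (x≤y<z i≤j j<a)
    rewrite rank-> a i (≤-<-trans i≤j j<a) | rank-> a j j<a =
    m<n⇒0<n∸m (toℕ<n+ a (toℕ i)) , ∸-monoˡ-≤ (toℕ a) (+-monoʳ-≤ n i≤j)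
  cyclic⇒cycInterval i j a (y<z<x j<a a<i)
    rewrite rank-≤ a i (<⇒≤ a<i) | rank-> a j j<a =
    m<n⇒0<n∸m a<i , ∸-monoˡ-≤ (toℕ a) (toℕ≤n+ i (toℕ j))
  cyclic⇒cycInterval i j a (z<x≤y a<i i≤j)
    rewrite rank-≤ a i (<⇒≤ a<i) | rank-≤ a j (≤-trans (<⇒≤ a<i) i≤j) =
    m<n⇒0<n∸m a<i , ∸-monoˡ-≤ (toℕ a) i≤j

  <[]⇔cycInterval : (i j a : Fin n) → j <[ i ] a ⇔ cycInterval a j i
  <[]⇔cycInterval i j a =
    mk⇔ (cyclic⇒cycInterval i j a ∘′ <[]⇒cyclic i j a)
        (cyclic⇒<[] i j a ∘′ cycInterval⇒cyclic i j a)

col-c-1⇒fixed : ∀ {n} (σ : DecoratedPerm n) (j : Fin n) → col σ j ≡ c-1 → perm σ ⟨$⟩ʳ j ≡ j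
col-c-1⇒fixed σ j c-1≡ with perm σ ⟨$⟩ʳ j ≟ᶠ j
... | yes fixed = fixed
... | no moved with trans (sym c-1≡) (Equivalence.from (col-ok σ j) moved)
...   | ()

∈necklace⇔∈grassInterval : ∀ {n} (σ : DecoratedPerm n) (i j : Fin n) →
  necklace σ i j ⇔ grassInterval σ j i
∈necklace⇔∈grassInterval σ i j = mk⇔ to from
  where
  to : necklace σ i j → grassInterval σ j i
  to (inj₂ c-1≡) = inj₁ (col-c-1⇒fixed σ j c-1≡ , c-1≡)
  to (inj₁ lt) with col σ j in c≡
  ... | c-1 = inj₁ (col-c-1⇒fixed σ j c≡ , refl)
  ... | c0  = inj₂ (inj₂ (λ ()) , Equivalence.to (<[]⇔cycInterval i j _) lt)
  ... | c+1 = inj₂ (inj₂ (λ ()) , Equivalence.to (<[]⇔cycInterval i j _) lt)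
  from : grassInterval σ j i → necklace σ i j
  from (inj₁ (_ , c-1≡))  = inj₂ c-1≡
  from (inj₂ (_ , i∈S)) = inj₁ (Equivalence.from (<[]⇔cycInterval i j _) i∈S)

⊆-transpose : {X Y : Set} {A B : X → Y → Set} {A′ B′ : Y → X → Set} →
  (∀ x y → A x y ⇔ A′ y x) → (∀ x y → B x y ⇔ B′ y x) →
  (∀ x y → A x y → B x y) ⇔ (∀ y x → A′ y x → B′ y x)
⊆-transpose A⇔ B⇔ =
  mk⇔ (λ A⊆B y x a′ → Equivalence.to (B⇔ x y) (A⊆B x y (Equivalence.from (A⇔ x y) a′)))
      (λ A′⊆B′ x y a → Equivalence.from (B⇔ x y) (A′⊆B′ y x (Equivalence.to (A⇔ x y) a)))

proposition5p2 : ∀ {n : ℕ} (σ π : DecoratedPerm n) →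
    ((∀ (i : Fin n) → necklace σ i ⊆ necklace π i)
      ⇔ (∀ (i : Fin n) → grassInterval σ i ⊆ grassInterval π i))
    × ((∀ (i : Fin n) → conecklace σ i ⊆ conecklace π i)
      ⇔ (∀ (i : Fin n) → grassInterval σ (perm σ ⟨$⟩ʳ i) ⊆ grassInterval π (perm π ⟨$⟩ʳ i)))
proposition5p2 σ π =
    ⊆-transpose (∈necklace⇔∈grassInterval σ) (∈necklace⇔∈grassInterval π)
  , ⊆-transpose (λ i k → ∈necklace⇔∈grassInterval σ i (perm σ ⟨$⟩ʳ k))
                (λ i k → ∈necklace⇔∈grassInterval π i (perm π ⟨$⟩ʳ k))
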